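{- Let $D$ be an $n\times n$ distance matrix and let $q_0$ be the smallest $q\in\mathbb{N}$ such that $D^{(q)}=D$, where $D^{(q)}$ is the distance matrix of the $q$-skeleton of $D$. Then every graph realisation $(G=(V,E),\Phi)$ of $D$ satisfies $|V|\ge n+(q_0-1)$.
   Context: $[n]=\{1,\dots,n\}$. An $n\times n$ matrix $D$ with non-negative integer entries is a distance matrix if all diagonal entries are $0$, all off-diagonal entries are strictly positive, $D$ is symmetric, and $D_{iw}+D_{wj}\ge D_{ij}$ for all $i,j,w$. A graph realisation of $D$ is a pair $(G,\Phi)$ with $G=(V,E)$ a finite simple undirected unweighted graph and $\Phi:[n]\to V$ injective such that $d_G(\Phi(i),\Phi(j))=D_{ij}$ for all $i,j$ ($d_G$ the shortest-path distance). For $q\in\mathbb{N}$, the $q$-skeleton of $D$ is the edge-weighted graph on vertex set $[n]$ with an edge $\{i,j\}$ ($i<j$) iff $D_{ij}\le q$, of weight $D_{ij}$; $D^{(q)}_{ij}$ is the weighted shortest-path distance from $i$ to $j$ in it ($\infty$ if none). -}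

module Defs where

open import Data.Nat using (ℕ; zero; suc; _+_; _≤_)
open import Data.Fin using (Fin)
open import Data.Bool using (Bool; true; false)
open import Data.Product using (_×_; Σ)
open import Relation.Binary.PropositionalEquality using (_≡_)
open import Relation.Nullary using (¬_)
open import Function.Definitions using (Injective)

Matrix : ℕ → Set
Matrix n = Fin n → Fin n → ℕ

record IsDistanceMatrix {n : ℕ} (D : Matrix n) : Set where
  field
    diag-zero : ∀ i → D i i ≡ 0
    off-pos   : ∀ i j → ¬ (i ≡ j) → 1 ≤ D i j
    symmetric : ∀ i j → D i j ≡ D j i
    triangle  : ∀ i j w → D i j ≤ D i w + D w j

record Graph (m : ℕ) : Set where
  field
    adj       : Fin m → Fin m → Bool
    adj-sym   : ∀ u v → adj u v ≡ adj v u
    adj-irrefl : ∀ v → adj v v ≡ false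

data Walk {m : ℕ} (G : Graph m) : Fin m → Fin m → ℕ → Set where
  here : ∀ {u} → Walk G u u 0
  step : ∀ {u w v k} → Graph.adj G u w ≡ true → Walk G w v k → Walk G u v (suc k)

GraphDist : {m : ℕ} → Graph m → Fin m → Fin m → ℕ → Set
GraphDist G u v k = Walk G u v k × (∀ j → Walk G u v j → k ≤ j)

-- Graph realisation (G, Φ) of D, with G on vertex set Fin m (so |V| = m).
record IsRealisation {n m : ℕ} (D : Matrix n) (G : Graph m) (Φ : Fin n → Fin m) : Set where
  field
    Φ-injective : Injective _≡_ _≡_ Φ
    realises    : ∀ i j → GraphDist G (Φ i) (Φ j) (D i j)

-- Walks of total weight w from i to j in the q-skeleton of D:
-- edges {i,j} with i ≠ j and D i j ≤ q, weight D i j.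
data SkelWalk {n : ℕ} (D : Matrix n) (q : ℕ) : Fin n → Fin n → ℕ → Set where
  here : ∀ {i} → SkelWalk D q i i 0
  step : ∀ {i k j w} → ¬ (i ≡ k) → D i k ≤ q →
         SkelWalk D q k j w → SkelWalk D q i j (D i k + w)

SkelDist : {n : ℕ} → Matrix n → ℕ → Fin n → Fin n → ℕ → Set
SkelDist D q i j d = SkelWalk D q i j d × (∀ w → SkelWalk D q i j w → d ≤ w)

SkeletonAgrees : {n : ℕ} → Matrix n → ℕ → Set
SkeletonAgrees D q = ∀ i j → SkelDist D q i j (D i j)

{-# OPTIONS --safe #-}
-- Put q = m + 1 - n.  If D i j > q, a shortest path from Φ i to Φ j has
-- D i j - 1 ≥ m - n + 1 inner vertices, all distinct; they cannot all avoid the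
-- n vertices Φ[n], so the path passes through some Φ a, which splits D i j as
-- D i a + D a j with both parts shorter.  Splitting repeatedly realises every
-- distance by a walk in the q-skeleton, so D^(q) = D and q₀ ≤ q by minimality.
module Submission where

open import Defs
open import Data.Nat using (ℕ; suc; _+_; _≤_)
open import Data.Fin using (Fin)
open import Data.Nat using (_∸_; _<_; _≤?_; s≤s)
open import Data.Nat.Induction using (<-wellFounded)
open import Data.Nat.Properties
  using (<-cmp; <⇒≱; ≰⇒>; ≤-reflexive; ≤-trans; ≤-antisym; ≤-pred; m≤n⇒m≤1+n; +-assoc; +-identityʳ
        ; +-monoˡ-<; +-monoʳ-≤; +-mono-≤; m≤n+m∸n; m+[n∸m]≡n; module ≤-Reasoning)
open import Data.Fin using (zero; suc; toℕ; inject₁; splitAt; _ℕ-ℕ_)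
open import Data.Fin.Properties
  using (_≟_; any?; injective⇒≤; toℕ-injective; inject₁ℕ<; nℕ-ℕi≤n; inject₁-injective; suc-injective; +↔⊎)
open import Data.Product using (∃; ∃₂; _×_; _,_; proj₂)
open import Data.Sum using (inj₁; inj₂; [_,_])
open import Function using (_∘_; Injection)
open import Function.Properties.Inverse using (↔⇒↣)
open import Function.Definitions using (Injective)
open import Induction.WellFounded using (Acc; acc)
open import Relation.Binary.Definitions using (tri<; tri≈; tri>)
open import Relation.Binary.PropositionalEquality using (_≡_; _≢_; refl; sym; cong; subst)
open import Relation.Nullary using (yes; no; contradiction)

disjoint-injections⇒≤ : ∀ {a b c} {f : Fin a → Fin c} {g : Fin b → Fin c} →
  Injective _≡_ _≡_ f → Injective _≡_ _≡_ g → (∀ x y → f x ≢ g y) → a + b ≤ c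
disjoint-injections⇒≤ {a} {f = f} {g} f-inj g-inj disjoint =
  injective⇒≤ {f = [ f , g ] ∘ splitAt a} (Injection.injective (↔⇒↣ +↔⊎) ∘ [f,g]-injective)
  where
  [f,g]-injective : Injective _≡_ _≡_ [ f , g ]
  [f,g]-injective {inj₁ x} {inj₁ y} eq = cong inj₁ (f-inj eq)
  [f,g]-injective {inj₁ x} {inj₂ y} eq = contradiction eq (disjoint x y)
  [f,g]-injective {inj₂ x} {inj₁ y} eq = contradiction (sym eq) (disjoint y x)
  [f,g]-injective {inj₂ x} {inj₂ y} eq = cong inj₂ (g-inj eq)

toℕ+ℕ-ℕ : ∀ k (r : Fin (suc k)) → toℕ r + (k ℕ-ℕ r) ≡ k
toℕ+ℕ-ℕ k       zero    = refl
toℕ+ℕ-ℕ (suc k) (suc r) = cong suc (toℕ+ℕ-ℕ k r)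

toℕ+ℕ-ℕ-< : ∀ k {s r : Fin (suc k)} → toℕ s < toℕ r → toℕ s + (k ℕ-ℕ r) < k
toℕ+ℕ-ℕ-< k {s} {r} s<r =
  subst (toℕ s + (k ℕ-ℕ r) <_) (toℕ+ℕ-ℕ k r) (+-monoˡ-< (k ℕ-ℕ r) s<r)

module _ {m : ℕ} {G : Graph m} where

  vertex : ∀ {u v k} → Walk G u v k → Fin (suc k) → Fin m
  vertex {u} _          zero    = u
  vertex     (step _ W) (suc s) = vertex W s

  prefix : ∀ {u v k} (W : Walk G u v k) (s : Fin (suc k)) → Walk G u (vertex W s) (toℕ s)
  prefix _          zero    = here
  prefix (step e W) (suc s) = step e (prefix W s)

  suffix : ∀ {u v k} (W : Walk G u v k) (s : Fin (suc k)) → Walk G (vertex W s) v (k ℕ-ℕ s)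
  suffix W          zero    = W
  suffix (step _ W) (suc s) = suffix W s

  _++_ : ∀ {u w v a b} → Walk G u w a → Walk G w v b → Walk G u v (a + b)
  here     ++ W′ = W′
  step e W ++ W′ = step e (W ++ W′)

  shortcut : ∀ {u v k} (W : Walk G u v k) {s r} → vertex W s ≡ vertex W r →
             Walk G u v (toℕ s + (k ℕ-ℕ r))
  shortcut {v = v} W {s} {r} eq =
    prefix W s ++ subst (λ x → Walk G x v _) (sym eq) (suffix W r)

  shortest⇒vertex-injective : ∀ {u v k} {W : Walk G u v k} →
    (∀ j → Walk G u v j → k ≤ j) → Injective _≡_ _≡_ (vertex W)
  shortest⇒vertex-injective {k = k} {W} shortest {s} {r} eq with <-cmp (toℕ s) (toℕ r)
  ... | tri< s<r _ _ = contradiction (shortest _ (shortcut W {s} {r} eq)) (<⇒≱ (toℕ+ℕ-ℕ-< k s<r))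
  ... | tri≈ _ s≡r _ = toℕ-injective s≡r
  ... | tri> _ _ r<s = contradiction (shortest _ (shortcut W {r} {s} (sym eq))) (<⇒≱ (toℕ+ℕ-ℕ-< k r<s))

inner : ∀ {k} → Fin k → Fin (suc (suc k))
inner s = suc (inject₁ s)

shortest-meets-image : ∀ {n m u v k} {G : Graph m} {Φ : Fin n → Fin m} →
  Injective _≡_ _≡_ Φ → (W : Walk G u v (suc k)) → (∀ j → Walk G u v j → suc k ≤ j) →
  m < n + k → ∃₂ λ a s → Φ a ≡ vertex W (inner s)
shortest-meets-image {Φ = Φ} Φ-inj W shortest m<n+k
  with any? (λ s → any? (λ a → Φ a ≟ vertex W (inner s)))
... | yes (s , a , hit) = a , s , hit
... | no miss = contradiction
        (disjoint-injections⇒≤ Φ-inj inner-injective (λ a s hit → miss (s , a , hit)))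
        (<⇒≱ m<n+k)
  where
  inner-injective : Injective _≡_ _≡_ (vertex W ∘ inner)
  inner-injective eq = inject₁-injective (suc-injective (shortest⇒vertex-injective {W = W} shortest eq))

Between : ∀ {n} → Matrix n → Fin n → Fin n → Fin n → Set
Between D i a j = D i a < D i j × D a j < D i j × D i a + D a j ≤ D i j

LongPairsSplit : ∀ {n} → Matrix n → ℕ → Set
LongPairsSplit D q = ∀ i j → q < D i j → ∃ λ a → Between D i a j

module _ {n m} {D : Matrix n} {G : Graph m} {Φ : Fin n → Fin m} (R : IsRealisation D G Φ) where
  open IsRealisation R

  realised-through : ∀ {i j k} (W : Walk G (Φ i) (Φ j) k) (s : Fin (suc k)) {a} →
    Φ a ≡ vertex W s → D i a ≤ toℕ s × D a j ≤ k ℕ-ℕ s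
  realised-through {i} {j} W s {a} hit =
    proj₂ (realises i a) _ (subst (λ x → Walk G (Φ i) x _) (sym hit) (prefix W s)) ,
    proj₂ (realises a j) _ (subst (λ x → Walk G x (Φ j) _) (sym hit) (suffix W s))

  realisation⇒longPairsSplit : LongPairsSplit D (suc m ∸ n)
  realisation⇒longPairsSplit i j q<Dij with D i j | realises i j
  realisation⇒longPairsSplit i j () | 0 | _
  realisation⇒longPairsSplit i j q<Dij | suc k | W , shortest
    with shortest-meets-image Φ-injective W shortest
           (≤-trans (m≤n+m∸n (suc m) n) (+-monoʳ-≤ n (≤-pred q<Dij)))
  ... | a , s , hit =
    let Dia≤ , Daj≤ = realised-through W (inner s) hit in
    a , s≤s (≤-trans Dia≤ (inject₁ℕ< s)) , s≤s (≤-trans Daj≤ (nℕ-ℕi≤n k (inject₁ s))) ,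
    ≤-trans (+-mono-≤ Dia≤ Daj≤) (≤-reflexive (toℕ+ℕ-ℕ (suc k) (inner s)))

_++ˢ_ : ∀ {n} {D : Matrix n} {q i k j w₁ w₂} →
  SkelWalk D q i k w₁ → SkelWalk D q k j w₂ → SkelWalk D q i j (w₁ + w₂)
here ++ˢ W′ = W′
_++ˢ_ {D = D} {q} {i} {j = j} {w₂ = w₂} (step {k = k} {w = w} i≢k Dik≤q W) W′ =
  subst (SkelWalk D q i j) (sym (+-assoc (D i k) w w₂)) (step i≢k Dik≤q (W ++ˢ W′))

module _ {n} {D : Matrix n} (isD : IsDistanceMatrix D) {q : ℕ} where
  open IsDistanceMatrix isD

  skelWalk⇒≤ : ∀ {i j w} → SkelWalk D q i j w → D i j ≤ w
  skelWalk⇒≤ {i} here = ≤-reflexive (diag-zero i)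
  skelWalk⇒≤ {i} {j} (step {k = k} _ _ W) =
    ≤-trans (triangle i j k) (+-monoʳ-≤ (D i k) (skelWalk⇒≤ W))

  longPairsSplit⇒skeletonAgrees : LongPairsSplit D q → SkeletonAgrees D q
  longPairsSplit⇒skeletonAgrees split i j =
    geodesic (<-wellFounded (D i j)) , λ _ → skelWalk⇒≤
    where
    geodesic : ∀ {i j} → Acc _<_ (D i j) → SkelWalk D q i j (D i j)
    geodesic {i} {j} (acc rec) with i ≟ j | D i j ≤? q
    ... | yes refl | _         = subst (SkelWalk D q i i) (sym (diag-zero i)) here
    ... | no i≢j   | yes Dij≤q = subst (SkelWalk D q i j) (+-identityʳ _) (step i≢j Dij≤q here)
    ... | no _     | no Dij≰q  =
      let a , Dia<Dij , Daj<Dij , Dia+Daj≤Dij = split i j (≰⇒> Dij≰q) in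
      subst (SkelWalk D q i j) (≤-antisym Dia+Daj≤Dij (triangle i j a))
        (geodesic (rec Dia<Dij) ++ˢ geodesic (rec Daj<Dij))

proposition5 : (n : ℕ) (D : Matrix n) → IsDistanceMatrix D →
    (q₀ : ℕ) → SkeletonAgrees D q₀ → (∀ q → SkeletonAgrees D q → q₀ ≤ q) →
    (m : ℕ) (G : Graph m) (Φ : Fin n → Fin m) → IsRealisation D G Φ →
    n + q₀ ≤ suc m
proposition5 n D isD q₀ _ minimal m G Φ R = begin
  n + q₀          ≤⟨ +-monoʳ-≤ n (minimal _ agrees) ⟩
  n + (suc m ∸ n) ≡⟨ m+[n∸m]≡n (m≤n⇒m≤1+n (injective⇒≤ (IsRealisation.Φ-injective R))) ⟩
  suc m           ∎
  where
  open ≤-Reasoning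
  agrees : SkeletonAgrees D (suc m ∸ n)
  agrees = longPairsSplit⇒skeletonAgrees isD (realisation⇒longPairsSplit R)
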